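{- Let $G$ be a properly laddered weighted graph and let $l$ be the number of ladders of $G$. Then there is a set of $2^l$ Hamiltonian paths on the vertex set of $G$, all of which are $G$-type, such that the union of any two distinct paths in the set contains a triangle.
   Context: A weighted graph is a graph whose edges each have weight $1$ or $2$. A Hamiltonian path $H$ on the vertex set of a weighted graph $G$ is $G$-type if for every edge $uv$ of $G$ of weight $w$, the distance between $u$ and $v$ in $H$ is exactly $w$. For $k\ge 1$, a $k$-ladder is a weighted graph on vertices $v_1,\dots,v_k,w_1,\dots,w_k$ whose weight-$1$ edges are $v_iw_i$ ($1\le i\le k$) and whose weight-$2$ edges are $v_iv_{i+1}$ and $w_iw_{i+1}$ ($1\le i\le k-1$); the pair $(v_1,w_1)$ is designated its top and $(v_k,w_k)$ its bottom. A ladder is a $k$-ladder for some $k\ge1$. A weighted graph is properly laddered if it is the vertex-disjoint union of some ladders, one isolated vertex (the apex), and a residual part, where the residual part is either empty, a single edge, or the union of two vertex-disjoint paths on $m+2$ and $m$ vertices for some positive integer $m$; all edges of the residual part have weight $2$. A Hamiltonian path on a vertex set is a spanning path, regarded as an unordered edge set; the union of two graphs on the same vertex set has the union of their edge sets. -}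

module Defs where

open import Data.Nat.Base using (ℕ; zero; suc; _+_; ∣_-_∣; _≤_)
open import Data.Fin.Base using (Fin; toℕ)
open import Data.Bool.Base using (Bool; true; false)
open import Data.Unit.Base using (⊤; tt)
open import Data.Empty using (⊥)
open import Data.Sum.Base using (_⊎_; inj₁; inj₂)
open import Data.Product.Base using (Σ; _×_; _,_; ∃)
open import Relation.Binary.PropositionalEquality using (_≡_; _≢_)
open import Function.Bundles using (_↔_; Inverse)

data Wt : Set where
  w1 w2 : Wt

⟦_⟧ : Wt → ℕ
⟦ w1 ⟧ = 1
⟦ w2 ⟧ = 2

-- Hamiltonian paths on a (finite) vertex type V:
-- an ordering of all vertices, i.e. a bijection  Fin N ↔ V
-- (position ↦ vertex).

HamPath : Set → Set
HamPath V = Σ ℕ λ N → Fin N ↔ V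

pos : {V : Set} → (H : HamPath V) → V → ℕ
pos (N , σ) v = toℕ (Inverse.from σ v)

distH : {V : Set} → HamPath V → V → V → ℕ
distH H u v = ∣ pos H u - pos H v ∣

PathEdge : {V : Set} → HamPath V → V → V → Set
PathEdge H u v = distH H u v ≡ 1

-- H is G-type, for a weighted graph given by its weighted edge relation
-- E u v w  ("uv is an edge of G of weight w").
GType : {V : Set} → (V → V → Wt → Set) → HamPath V → Set
GType {V} E H = ∀ (u v : V) (w : Wt) → E u v w → distH H u v ≡ ⟦ w ⟧

UnionHasTriangle : {V : Set} → HamPath V → HamPath V → Set
UnionHasTriangle {V} H₁ H₂ =
  Σ V λ a → Σ V λ b → Σ V λ c →
    (a ≢ b) × (b ≢ c) × (a ≢ c) ×
    (PathEdge H₁ a b ⊎ PathEdge H₂ a b) ×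
    (PathEdge H₁ b c ⊎ PathEdge H₂ b c) ×
    (PathEdge H₁ a c ⊎ PathEdge H₂ a c)

-- l ladders; ladder i is a (ks i)-ladder with ks i ≥ 1.
-- Ladder vertex (i , false , j) is v_{j+1}, (i , true , j) is w_{j+1}.

LadderV : (l : ℕ) → (Fin l → ℕ) → Set
LadderV l ks = Σ (Fin l) λ i → Bool × Fin (ks i)

data LadderE (l : ℕ) (ks : Fin l → ℕ) : LadderV l ks → LadderV l ks → Wt → Set where
  rung : ∀ i (j : Fin (ks i)) → LadderE l ks (i , false , j) (i , true , j) w1
  rail : ∀ i (b : Bool) (j j' : Fin (ks i)) → toℕ j' ≡ suc (toℕ j) →
         LadderE l ks (i , b , j) (i , b , j') w2

-- The residual part: empty, a single edge, or two disjoint paths on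
-- m+2 and m vertices (m ≥ 1; the hypothesis m ≥ 1 is imposed in the
-- theorem).  All residual edges have weight 2.
data Residual : Set where
  empty   : Residual
  oneEdge : Residual
  twoPaths : (m : ℕ) → Residual

ResV : Residual → Set
ResV empty        = ⊥
ResV oneEdge      = Bool
ResV (twoPaths m) = Fin (m + 2) ⊎ Fin m

data ResE : (r : Residual) → ResV r → ResV r → Wt → Set where
  edgeE  : ResE oneEdge false true w2
  longE  : ∀ {m} (j j' : Fin (m + 2)) → toℕ j' ≡ suc (toℕ j) →
           ResE (twoPaths m) (inj₁ j) (inj₁ j') w2
  shortE : ∀ {m} (j j' : Fin m) → toℕ j' ≡ suc (toℕ j) →
           ResE (twoPaths m) (inj₂ j) (inj₂ j') w2

ValidResidual : Residual → Set
ValidResidual empty        = ⊤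
ValidResidual oneEdge      = ⊤
ValidResidual (twoPaths m) = 1 ≤ m

PLV : (l : ℕ) → (Fin l → ℕ) → Residual → Set
PLV l ks r = LadderV l ks ⊎ (⊤ ⊎ ResV r)

data PLE (l : ℕ) (ks : Fin l → ℕ) (r : Residual) :
         PLV l ks r → PLV l ks r → Wt → Set where
  ladE : ∀ {x y w} → LadderE l ks x y w → PLE l ks r (inj₁ x) (inj₁ y) w
  resE : ∀ {x y w} → ResE r x y w → PLE l ks r (inj₂ (inj₂ x)) (inj₂ (inj₂ y)) w

-- Lay out the vertices as: the residual part with the apex, then the ladders one
-- after another, each ladder rung by rung.  Rails then join vertices two apart and
-- rungs join neighbours, in either orientation of the rungs of a ladder, so each of
-- the 2^l choices of orientations gives a G-type path.  If two choices first differ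
-- at ladder i, the vertex y just before ladder i is the same in both paths and is
-- followed by v₁ in one of them and by w₁ in the other; together with the rung v₁w₁
-- this is a triangle.

module Submission where

open import Defs
open import Data.Nat.Base using (ℕ; zero; suc; _+_; _*_; _^_; ∣_-_∣; _≤_)
open import Data.Nat.Properties
  using (suc-injective; +-assoc; +-comm; +-suc; +-identityʳ; *-comm; *-suc; ∣n-n∣≡0; ∣m-m+n∣≡n; ∣m+n-m+o∣≡∣n-o∣)
open import Data.Fin.Base using (Fin; Fin′; toℕ; zero; suc; inject; fromℕ; fromℕ<; combine; finToFun; funToFin)
open import Data.Fin.Properties
  using (0↔⊥; 1↔⊤; 2↔Bool; +↔⊎; *↔×; toℕ-↑ˡ; toℕ-↑ʳ; toℕ-combine; toℕ-fromℕ; toℕ-fromℕ<; toℕ-inject;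
         funToFin-finToFin; ¬∀⟶∃¬-smallest)
open import Data.Bool.Base using (Bool; true; false; not)
open import Data.Bool.Properties using (not-involutive; ¬-not) renaming (_≟_ to _≟ᵇ_)
open import Data.Unit.Base using (⊤; tt)
open import Data.Empty using (⊥)
open import Data.Sum.Base using (_⊎_; inj₁; inj₂)
open import Data.Sum.Algebra using (⊎-comm)
open import Data.Sum.Function.Propositional using (_⊎-↔_)
open import Data.Product.Base using (Σ; _×_; _,_; proj₁; proj₂)
open import Data.Product.Algebra using (×-comm)
open import Data.Product.Function.NonDependent.Propositional using (_×-↔_)
open import Function.Base using (_∘_)
open import Function.Bundles using (_↔_; Inverse; mk↔ₛ′)
open import Function.Properties.Inverse using (↔-refl; ↔-trans; ↔-sym)
open import Relation.Binary.PropositionalEquality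

private variable
  A B V : Set
  n : ℕ

-- Hamiltonian paths as vertex orderings

len : HamPath V → ℕ
len = proj₁

LastVertex : HamPath V → Set
LastVertex {V} H = Σ V λ v → suc (pos H v) ≡ len H

relabel : A ↔ B → HamPath A → HamPath B
relabel e H = len H , ↔-trans (proj₂ H) e

emptyPath : HamPath ⊥
emptyPath = 0 , 0↔⊥

unitPath : HamPath ⊤
unitPath = 1 , 1↔⊤

finPath : ∀ k → HamPath (Fin k)
finPath k = k , ↔-refl

_⊕_ : HamPath A → HamPath B → HamPath (A ⊎ B)
H ⊕ K = len H + len K , ↔-trans +↔⊎ (proj₂ H ⊎-↔ proj₂ K)

_⊗_ : HamPath A → HamPath B → HamPath (A × B)
H ⊗ K = len H * len K , ↔-trans *↔× (proj₂ H ×-↔ proj₂ K)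

⊎↔Σ-Fin-suc : {X : Fin (suc n) → Set} → (X zero ⊎ Σ (Fin n) (X ∘ suc)) ↔ Σ (Fin (suc n)) X
⊎↔Σ-Fin-suc = mk↔ₛ′
  (λ { (inj₁ x) → zero , x ; (inj₂ (i , x)) → suc i , x })
  (λ { (zero , x) → inj₁ x ; (suc i , x) → inj₂ (i , x) })
  (λ { (zero , x) → refl ; (suc i , x) → refl })
  (λ { (inj₁ x) → refl ; (inj₂ (i , x)) → refl })

⨁ : {X : Fin n → Set} → ((i : Fin n) → HamPath (X i)) → HamPath (Σ (Fin n) X)
⨁ {zero}  H = relabel (mk↔ₛ′ (λ ()) (λ ()) (λ ()) (λ ())) emptyPath
⨁ {suc n} H = relabel ⊎↔Σ-Fin-suc (H zero ⊕ ⨁ (H ∘ suc))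

offset : (Fin n → ℕ) → Fin n → ℕ
offset ℓ zero    = 0
offset ℓ (suc i) = ℓ zero + offset (ℓ ∘ suc) i

offset-step : (ℓ : Fin n → ℕ) {i j : Fin n} → toℕ i ≡ suc (toℕ j) → offset ℓ i ≡ offset ℓ j + ℓ j
offset-step ℓ {suc zero}    {zero}  _ = +-identityʳ (ℓ zero)
offset-step ℓ {suc (suc _)} {zero}  ()
offset-step ℓ {suc i}       {suc j} eq = begin
  ℓ zero + offset (ℓ ∘ suc) i              ≡⟨ cong (ℓ zero +_) (offset-step (ℓ ∘ suc) (suc-injective eq)) ⟩
  ℓ zero + (offset (ℓ ∘ suc) j + ℓ (suc j)) ≡⟨ +-assoc (ℓ zero) _ _ ⟨
  ℓ zero + offset (ℓ ∘ suc) j + ℓ (suc j)   ∎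
  where open ≡-Reasoning

pos-⊕ˡ : (H : HamPath A) (K : HamPath B) (a : A) → pos (H ⊕ K) (inj₁ a) ≡ pos H a
pos-⊕ˡ H K a = toℕ-↑ˡ (Inverse.from (proj₂ H) a) (len K)

pos-⊕ʳ : (H : HamPath A) (K : HamPath B) (b : B) → pos (H ⊕ K) (inj₂ b) ≡ len H + pos K b
pos-⊕ʳ H K b = toℕ-↑ʳ (len H) (Inverse.from (proj₂ K) b)

pos-⊗ : (H : HamPath A) (K : HamPath B) (a : A) (b : B) → pos (H ⊗ K) (a , b) ≡ len K * pos H a + pos K b
pos-⊗ H K a b = toℕ-combine {len H} {len K} (Inverse.from (proj₂ H) a) (Inverse.from (proj₂ K) b)

pos-⨁ : {X : Fin n → Set} (H : (i : Fin n) → HamPath (X i)) (i : Fin n) (x : X i) →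
        pos (⨁ H) (i , x) ≡ offset (λ j → len (H j)) i + pos (H i) x
pos-⨁ {suc n} H zero    x = pos-⊕ˡ (H zero) (⨁ (H ∘ suc)) x
pos-⨁ {suc n} H (suc i) x = begin
  pos (H zero ⊕ ⨁ (H ∘ suc)) (inj₂ (i , x))
    ≡⟨ pos-⊕ʳ (H zero) (⨁ (H ∘ suc)) (i , x) ⟩
  len (H zero) + pos (⨁ (H ∘ suc)) (i , x)
    ≡⟨ cong (len (H zero) +_) (pos-⨁ (H ∘ suc) i x) ⟩
  len (H zero) + (offset (λ j → len (H (suc j))) i + pos (H (suc i)) x)
    ≡⟨ +-assoc (len (H zero)) _ _ ⟨
  offset (λ j → len (H j)) (suc i) + pos (H (suc i)) x ∎
  where open ≡-Reasoning

last-relabel : (e : A ↔ B) (H : HamPath A) → LastVertex H → LastVertex (relabel e H)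
last-relabel e H (v , last) = Inverse.to e v , trans (cong (suc ∘ pos H) (Inverse.strictlyInverseʳ e v)) last

last-⊕ʳ : (H : HamPath A) (K : HamPath B) → LastVertex K → LastVertex (H ⊕ K)
last-⊕ʳ H K (v , last) = inj₂ v , (begin
  suc (pos (H ⊕ K) (inj₂ v)) ≡⟨ cong suc (pos-⊕ʳ H K v) ⟩
  suc (len H + pos K v)      ≡⟨ +-suc (len H) (pos K v) ⟨
  len H + suc (pos K v)      ≡⟨ cong (len H +_) last ⟩
  len H + len K              ∎)
  where open ≡-Reasoning

last-⊗ : (H : HamPath A) (K : HamPath B) → LastVertex H → LastVertex K → LastVertex (H ⊗ K)
last-⊗ H K (a , lastH) (b , lastK) = (a , b) , (begin
  suc (pos (H ⊗ K) (a , b))      ≡⟨ cong suc (pos-⊗ H K a b) ⟩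
  suc (len K * pos H a + pos K b) ≡⟨ +-suc (len K * pos H a) (pos K b) ⟨
  len K * pos H a + suc (pos K b) ≡⟨ cong (len K * pos H a +_) lastK ⟩
  len K * pos H a + len K         ≡⟨ +-comm (len K * pos H a) (len K) ⟩
  len K + len K * pos H a         ≡⟨ *-suc (len K) (pos H a) ⟨
  len K * suc (pos H a)           ≡⟨ cong (len K *_) lastH ⟩
  len K * len H                   ≡⟨ *-comm (len K) (len H) ⟩
  len H * len K                   ∎)
  where open ≡-Reasoning

∣m+o-n+o∣≡∣m-n∣ : ∀ m n o → ∣ m + o - n + o ∣ ≡ ∣ m - n ∣
∣m+o-n+o∣≡∣m-n∣ m n o = trans (cong₂ ∣_-_∣ (+-comm m o) (+-comm n o)) (∣m+n-m+o∣≡∣n-o∣ o m n)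

∣m*n-m*[1+n]∣≡m : ∀ m n → ∣ m * n - m * suc n ∣ ≡ m
∣m*n-m*[1+n]∣≡m m n = trans (cong (∣ m * n -_∣) (trans (*-suc m n) (+-comm m (m * n)))) (∣m-m+n∣≡n (m * n) m)

distH-shift : (H : HamPath V) (K : HamPath A) (f : A → V) {s : ℕ} →
              (∀ x → pos H (f x) ≡ s + pos K x) → ∀ x y → distH H (f x) (f y) ≡ distH K x y
distH-shift H K f {s} shift x y =
  trans (cong₂ ∣_-_∣ (shift x) (shift y)) (∣m+n-m+o∣≡∣n-o∣ s (pos K x) (pos K y))

distH-⊗-step : (H : HamPath A) (K : HamPath B) {a a' : A} → pos H a' ≡ suc (pos H a) →
               ∀ x → distH (H ⊗ K) (a , x) (a' , x) ≡ len K
distH-⊗-step H K {a} {a'} step x = begin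
  ∣ pos (H ⊗ K) (a , x) - pos (H ⊗ K) (a' , x) ∣
    ≡⟨ cong₂ ∣_-_∣ (pos-⊗ H K a x) (pos-⊗ H K a' x) ⟩
  ∣ len K * pos H a + pos K x - len K * pos H a' + pos K x ∣
    ≡⟨ ∣m+o-n+o∣≡∣m-n∣ (len K * pos H a) (len K * pos H a') (pos K x) ⟩
  ∣ len K * pos H a - len K * pos H a' ∣
    ≡⟨ cong (λ p → ∣ len K * pos H a - len K * p ∣) step ⟩
  ∣ len K * pos H a - len K * suc (pos H a) ∣
    ≡⟨ ∣m*n-m*[1+n]∣≡m (len K) (pos H a) ⟩
  len K ∎
  where open ≡-Reasoning

consecutive⇒PathEdge : (H : HamPath V) {u v : V} {m : ℕ} → pos H u ≡ m → pos H v ≡ suc m → PathEdge H u v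
consecutive⇒PathEdge H {m = m} u↦m v↦m+1 =
  trans (cong₂ ∣_-_∣ u↦m v↦m+1) (trans (cong (∣ m -_∣) (+-comm 1 m)) (∣m-m+n∣≡n m 1))

PathEdge⇒≢ : (H : HamPath V) {u v : V} → PathEdge H u v → u ≢ v
PathEdge⇒≢ H {u} edge refl with () ← trans (sym edge) (∣n-n∣≡0 (pos H u))

swappedSuccessors⇒UnionHasTriangle : (H H' : HamPath V) (y a b : V) {p : ℕ} →
  pos H y ≡ p → pos H' y ≡ p → pos H a ≡ suc p → pos H b ≡ suc (suc p) → pos H' b ≡ suc p →
  UnionHasTriangle H H'
swappedSuccessors⇒UnionHasTriangle H H' y a b y↦p y↦p' a↦p+1 b↦p+2 b↦p+1' =
  y , a , b , PathEdge⇒≢ H ya , PathEdge⇒≢ H ab , PathEdge⇒≢ H' yb , inj₁ ya , inj₁ ab , inj₂ yb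
  where
  ya = consecutive⇒PathEdge H y↦p a↦p+1
  ab = consecutive⇒PathEdge H a↦p+1 b↦p+2
  yb = consecutive⇒PathEdge H' y↦p' b↦p+1'

-- Ladders and the residual part

rungPath : Bool → HamPath Bool
rungPath c = 2 , orient c
  where
  orient : Bool → Fin 2 ↔ Bool
  orient false = 2↔Bool
  orient true  = ↔-trans 2↔Bool (mk↔ₛ′ not not not-involutive not-involutive)

rungPath-first : ∀ c → pos (rungPath c) c ≡ 0
rungPath-first false = refl
rungPath-first true  = refl

rungPath-second : ∀ c → pos (rungPath c) (not c) ≡ 1
rungPath-second false = refl
rungPath-second true  = refl

rungPath-edge : ∀ c → distH (rungPath c) false true ≡ 1
rungPath-edge false = refl
rungPath-edge true  = refl

ladderPath : Bool → (k : ℕ) → HamPath (Bool × Fin k)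
ladderPath c k = relabel (×-comm _ _) (finPath k ⊗ rungPath c)

pos-ladderPath : ∀ c k (j : Fin k) b → pos (ladderPath c k) (b , j) ≡ 2 * toℕ j + pos (rungPath c) b
pos-ladderPath c k j b = pos-⊗ (finPath k) (rungPath c) j b

ladderPath-rung : ∀ c k (j : Fin k) → distH (ladderPath c k) (false , j) (true , j) ≡ 1
ladderPath-rung c k j =
  trans (distH-shift (ladderPath c k) (rungPath c) (_, j) (pos-ladderPath c k j) false true)
        (rungPath-edge c)

ladderPath-rail : ∀ c k b {j j' : Fin k} → toℕ j' ≡ suc (toℕ j) → distH (ladderPath c k) (b , j) (b , j') ≡ 2
ladderPath-rail c k b step = distH-⊗-step (finPath k) (rungPath c) step b

ladderPath-last : ∀ c {k} → 1 ≤ k → LastVertex (ladderPath c k)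
ladderPath-last c {suc k} _ =
  last-relabel (×-comm _ _) (finPath (suc k) ⊗ rungPath c)
    (last-⊗ (finPath (suc k)) (rungPath c) (fromℕ k , cong suc (toℕ-fromℕ k)) (not c , cong suc (rungPath-second c)))

laddersPath : {l : ℕ} (ks : Fin l → ℕ) → (Fin l → Bool) → HamPath (LadderV l ks)
laddersPath ks c = ⨁ λ i → ladderPath (c i) (ks i)

apexBetween : (⊤ ⊎ (⊤ ⊎ ⊤)) ↔ (⊤ ⊎ ResV (twoPaths 0))
apexBetween = mk↔ₛ′
  (λ { (inj₁ _) → inj₂ (inj₁ zero) ; (inj₂ (inj₁ _)) → inj₁ tt ; (inj₂ (inj₂ _)) → inj₂ (inj₁ (suc zero)) })
  (λ { (inj₁ _) → inj₂ (inj₁ tt) ; (inj₂ (inj₁ zero)) → inj₁ tt ; (inj₂ (inj₁ (suc zero))) → inj₂ (inj₂ tt) })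
  (λ { (inj₁ _) → refl ; (inj₂ (inj₁ zero)) → refl ; (inj₂ (inj₁ (suc zero))) → refl })
  (λ { (inj₁ _) → refl ; (inj₂ (inj₁ _)) → refl ; (inj₂ (inj₂ _)) → refl })

firstRow : ∀ m → (Bool ⊎ (⊤ ⊎ ResV (twoPaths m))) ↔ (⊤ ⊎ ResV (twoPaths (suc m)))
firstRow m = mk↔ₛ′
  (λ { (inj₁ false) → inj₂ (inj₁ zero) ; (inj₁ true) → inj₂ (inj₂ zero) ; (inj₂ (inj₁ _)) → inj₁ tt
     ; (inj₂ (inj₂ (inj₁ a))) → inj₂ (inj₁ (suc a)) ; (inj₂ (inj₂ (inj₂ b))) → inj₂ (inj₂ (suc b)) })
  (λ { (inj₂ (inj₁ zero)) → inj₁ false ; (inj₂ (inj₂ zero)) → inj₁ true ; (inj₁ _) → inj₂ (inj₁ tt)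
     ; (inj₂ (inj₁ (suc a))) → inj₂ (inj₂ (inj₁ a)) ; (inj₂ (inj₂ (suc b))) → inj₂ (inj₂ (inj₂ b)) })
  (λ { (inj₂ (inj₁ zero)) → refl ; (inj₂ (inj₂ zero)) → refl ; (inj₁ _) → refl
     ; (inj₂ (inj₁ (suc a))) → refl ; (inj₂ (inj₂ (suc b))) → refl })
  (λ { (inj₁ false) → refl ; (inj₁ true) → refl ; (inj₂ (inj₁ _)) → refl
     ; (inj₂ (inj₂ (inj₁ a))) → refl ; (inj₂ (inj₂ (inj₂ b))) → refl })

-- Order L₀ S₀ L₁ S₁ … L_{m-1} S_{m-1} L_m ∗ L_{m+1}, where Lⱼ = inj₁ j is on the long
-- path, Sⱼ = inj₂ j on the short one and ∗ is the apex: the apex fills the gap that the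
-- rail L_m L_{m+1} of weight 2 needs.
twoPathsPath : ∀ m → HamPath (⊤ ⊎ ResV (twoPaths m))
twoPathsPath zero    = relabel apexBetween (unitPath ⊕ (unitPath ⊕ unitPath))
twoPathsPath (suc m) = relabel (firstRow m) (rungPath false ⊕ twoPathsPath m)

pos-twoPathsPath-long : ∀ m (a : Fin (m + 2)) → pos (twoPathsPath m) (inj₂ (inj₁ a)) ≡ 2 * toℕ a
pos-twoPathsPath-long zero    zero          = refl
pos-twoPathsPath-long zero    (suc zero)    = refl
pos-twoPathsPath-long (suc m) zero          = refl
pos-twoPathsPath-long (suc m) (suc a)       =
  trans (cong (2 +_) (pos-twoPathsPath-long m a)) (sym (*-suc 2 (toℕ a)))

pos-twoPathsPath-short : ∀ m (b : Fin m) → pos (twoPathsPath m) (inj₂ (inj₂ b)) ≡ suc (2 * toℕ b)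
pos-twoPathsPath-short (suc m) zero    = refl
pos-twoPathsPath-short (suc m) (suc b) =
  trans (cong (2 +_) (pos-twoPathsPath-short m b)) (cong suc (sym (*-suc 2 (toℕ b))))

twoPathsPath-last : ∀ m → LastVertex (twoPathsPath m)
twoPathsPath-last zero    = inj₂ (inj₁ (suc zero)) , refl
twoPathsPath-last (suc m) = last-relabel (firstRow m) (rungPath false ⊕ twoPathsPath m)
  (last-⊕ʳ (rungPath false) (twoPathsPath m) (twoPathsPath-last m))

twoPathsPath-GType : ∀ {m} {x y : ResV (twoPaths m)} {w} → ResE (twoPaths m) x y w →
                    distH (twoPathsPath m) (inj₂ x) (inj₂ y) ≡ ⟦ w ⟧
twoPathsPath-GType {m} (longE j j' step) = begin
  ∣ pos (twoPathsPath m) (inj₂ (inj₁ j)) - pos (twoPathsPath m) (inj₂ (inj₁ j')) ∣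
    ≡⟨ cong₂ ∣_-_∣ (pos-twoPathsPath-long m j) (trans (pos-twoPathsPath-long m j') (cong (2 *_) step)) ⟩
  ∣ 2 * toℕ j - 2 * suc (toℕ j) ∣
    ≡⟨ ∣m*n-m*[1+n]∣≡m 2 (toℕ j) ⟩
  2 ∎
  where open ≡-Reasoning
twoPathsPath-GType {m} (shortE j j' step) = begin
  ∣ pos (twoPathsPath m) (inj₂ (inj₂ j)) - pos (twoPathsPath m) (inj₂ (inj₂ j')) ∣
    ≡⟨ cong₂ ∣_-_∣ (pos-twoPathsPath-short m j)
                   (trans (pos-twoPathsPath-short m j') (cong (λ (n : ℕ) → suc (2 * n)) step)) ⟩
  ∣ 2 * toℕ j - 2 * suc (toℕ j) ∣
    ≡⟨ ∣m*n-m*[1+n]∣≡m 2 (toℕ j) ⟩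
  2 ∎
  where open ≡-Reasoning

oneEdge↔twoPaths0 : (⊤ ⊎ ResV (twoPaths 0)) ↔ (⊤ ⊎ ResV oneEdge)
oneEdge↔twoPaths0 = ↔-refl ⊎-↔ ↔-trans (↔-sym +↔⊎) 2↔Bool

residualPath : (r : Residual) → HamPath (⊤ ⊎ ResV r)
residualPath empty        = unitPath ⊕ emptyPath
residualPath oneEdge      = relabel oneEdge↔twoPaths0 (twoPathsPath 0)
residualPath (twoPaths m) = twoPathsPath m

residualPath-GType : ∀ {r x y w} → ResE r x y w → distH (residualPath r) (inj₂ x) (inj₂ y) ≡ ⟦ w ⟧
residualPath-GType edgeE                = refl
residualPath-GType e@(longE _ _ _)      = twoPathsPath-GType e
residualPath-GType e@(shortE _ _ _)     = twoPathsPath-GType e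

residualPath-last : ∀ r → LastVertex (residualPath r)
residualPath-last empty        = inj₁ tt , refl
residualPath-last oneEdge      = last-relabel oneEdge↔twoPaths0 (twoPathsPath 0) (twoPathsPath-last 0)
residualPath-last (twoPaths m) = twoPathsPath-last m

-- The paths of a properly laddered graph

module _ {l : ℕ} (ks : Fin l → ℕ) (r : Residual) where

  fullPath : (Fin l → Bool) → HamPath (PLV l ks r)
  fullPath c = relabel (⊎-comm _ _) (residualPath r ⊕ laddersPath ks c)

  ladderLength : Fin l → ℕ
  ladderLength i = ks i * 2

  ladderStart : Fin l → ℕ
  ladderStart i = len (residualPath r) + offset ladderLength i

  pos-fullPath-residual : ∀ c x → pos (fullPath c) (inj₂ x) ≡ pos (residualPath r) x
  pos-fullPath-residual c = pos-⊕ˡ (residualPath r) (laddersPath ks c)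

  pos-fullPath-ladder : ∀ c i x →
    pos (fullPath c) (inj₁ (i , x)) ≡ ladderStart i + pos (ladderPath (c i) (ks i)) x
  pos-fullPath-ladder c i x = begin
    pos (residualPath r ⊕ laddersPath ks c) (inj₂ (i , x))
      ≡⟨ pos-⊕ʳ (residualPath r) (laddersPath ks c) (i , x) ⟩
    len (residualPath r) + pos (laddersPath ks c) (i , x)
      ≡⟨ cong (len (residualPath r) +_) (pos-⨁ (λ j → ladderPath (c j) (ks j)) i x) ⟩
    len (residualPath r) + (offset ladderLength i + pos (ladderPath (c i) (ks i)) x)
      ≡⟨ +-assoc (len (residualPath r)) _ _ ⟨
    ladderStart i + pos (ladderPath (c i) (ks i)) x ∎
    where open ≡-Reasoning

  distH-fullPath-ladder : ∀ c i x y →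
    distH (fullPath c) (inj₁ (i , x)) (inj₁ (i , y)) ≡ distH (ladderPath (c i) (ks i)) x y
  distH-fullPath-ladder c i =
    distH-shift (fullPath c) (ladderPath (c i) (ks i)) (λ x → inj₁ (i , x)) (pos-fullPath-ladder c i)

  distH-fullPath-residual : ∀ c x y → distH (fullPath c) (inj₂ x) (inj₂ y) ≡ distH (residualPath r) x y
  distH-fullPath-residual c = distH-shift (fullPath c) (residualPath r) inj₂ (pos-fullPath-residual c)

  fullPath-GType : ∀ c → GType (PLE l ks r) (fullPath c)
  fullPath-GType c _ _ _ (ladE (rung i j)) =
    trans (distH-fullPath-ladder c i (false , j) (true , j)) (ladderPath-rung (c i) (ks i) j)
  fullPath-GType c _ _ _ (ladE (rail i b j j' step)) =
    trans (distH-fullPath-ladder c i (b , j) (b , j')) (ladderPath-rail (c i) (ks i) b step)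
  fullPath-GType c _ _ _ (resE e) =
    trans (distH-fullPath-residual c _ _) (residualPath-GType e)

  module _ (ks≥1 : ∀ i → 1 ≤ ks i) where

    sharedPredecessor : ∀ c c' (i : Fin l) → ((j : Fin′ i) → c (inject j) ≡ c' (inject j)) →
      Σ (PLV l ks r) λ y → (pos (fullPath c') y ≡ pos (fullPath c) y) × (suc (pos (fullPath c) y) ≡ ladderStart i)
    sharedPredecessor c c' zero _ =
      inj₂ v , trans (pos-fullPath-residual c' v) (sym (pos-fullPath-residual c v)) , (begin
      suc (pos (fullPath c) (inj₂ v))  ≡⟨ cong suc (pos-fullPath-residual c v) ⟩
      suc (pos (residualPath r) v)     ≡⟨ proj₂ (residualPath-last r) ⟩
      len (residualPath r)             ≡⟨ +-identityʳ _ ⟨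
      ladderStart zero                 ∎)
      where
      open ≡-Reasoning
      v = proj₁ (residualPath-last r)
    sharedPredecessor c c' (suc i) agree = inj₁ (j , v) , same , (begin
      suc (pos (fullPath c) (inj₁ (j , v)))               ≡⟨ cong suc (pos-fullPath-ladder c j v) ⟩
      suc (ladderStart j + pos (ladderPath (c j) (ks j)) v) ≡⟨ +-suc (ladderStart j) _ ⟨
      ladderStart j + suc (pos (ladderPath (c j) (ks j)) v)
        ≡⟨ cong (ladderStart j +_) (proj₂ (ladderPath-last (c j) (ks≥1 j))) ⟩
      ladderStart j + ladderLength j                        ≡⟨ +-assoc (len (residualPath r)) _ _ ⟩
      len (residualPath r) + (offset ladderLength j + ladderLength j)
        ≡⟨ cong (len (residualPath r) +_) (offset-step ladderLength (cong suc (sym j≡i))) ⟨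
      ladderStart (suc i)                                   ∎)
      where
      open ≡-Reasoning
      k : Fin′ (suc i)
      k = fromℕ (toℕ i)
      j = inject k
      j≡i : toℕ j ≡ toℕ i
      j≡i = trans (toℕ-inject k) (toℕ-fromℕ (toℕ i))
      v = proj₁ (ladderPath-last (c j) (ks≥1 j))
      same : pos (fullPath c') (inj₁ (j , v)) ≡ pos (fullPath c) (inj₁ (j , v))
      same = begin
        pos (fullPath c') (inj₁ (j , v))                ≡⟨ pos-fullPath-ladder c' j v ⟩
        ladderStart j + pos (ladderPath (c' j) (ks j)) v
          ≡⟨ cong (λ o → ladderStart j + pos (ladderPath o (ks j)) v) (agree k) ⟨
        ladderStart j + pos (ladderPath (c j) (ks j)) v  ≡⟨ pos-fullPath-ladder c j v ⟨
        pos (fullPath c) (inj₁ (j , v))                 ∎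

    pos-fullPath-firstRung : ∀ c i b →
      pos (fullPath c) (inj₁ (i , b , fromℕ< (ks≥1 i))) ≡ ladderStart i + pos (rungPath (c i)) b
    pos-fullPath-firstRung c i b = begin
      pos (fullPath c) (inj₁ (i , b , j₀))                  ≡⟨ pos-fullPath-ladder c i (b , j₀) ⟩
      ladderStart i + pos (ladderPath (c i) (ks i)) (b , j₀)
        ≡⟨ cong (ladderStart i +_) (pos-ladderPath (c i) (ks i) j₀ b) ⟩
      ladderStart i + (2 * toℕ j₀ + pos (rungPath (c i)) b)
        ≡⟨ cong (λ n → ladderStart i + (2 * n + pos (rungPath (c i)) b)) (toℕ-fromℕ< (ks≥1 i)) ⟩
      ladderStart i + pos (rungPath (c i)) b                  ∎
      where
      open ≡-Reasoning
      j₀ = fromℕ< (ks≥1 i)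

    fullPath-triangle : ∀ c c' (i : Fin l) → c i ≢ c' i → ((j : Fin′ i) → c (inject j) ≡ c' (inject j)) →
                        UnionHasTriangle (fullPath c) (fullPath c')
    fullPath-triangle c c' i c≢c' agree =
      swappedSuccessors⇒UnionHasTriangle (fullPath c) (fullPath c') y (firstRung (c i)) (firstRung (c' i))
        refl same-place
        (at-start c (c i) (rungPath-first (c i)))
        (after-start c (c' i) (trans (cong (pos (rungPath (c i))) c'≡¬c) (rungPath-second (c i))))
        (at-start c' (c' i) (rungPath-first (c' i)))
      where
      open ≡-Reasoning
      predecessor = sharedPredecessor c c' i agree
      y = proj₁ predecessor
      same-place = proj₁ (proj₂ predecessor)
      p = pos (fullPath c) y
      p+1≡start = proj₂ (proj₂ predecessor)
      c'≡¬c : c' i ≡ not (c i)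
      c'≡¬c = ¬-not (c≢c' ∘ sym)
      firstRung : Bool → PLV l ks r
      firstRung b = inj₁ (i , b , fromℕ< (ks≥1 i))
      at-start : ∀ d b → pos (rungPath (d i)) b ≡ 0 → pos (fullPath d) (firstRung b) ≡ suc p
      at-start d b first = begin
        pos (fullPath d) (firstRung b)         ≡⟨ pos-fullPath-firstRung d i b ⟩
        ladderStart i + pos (rungPath (d i)) b ≡⟨ cong (ladderStart i +_) first ⟩
        ladderStart i + 0                      ≡⟨ +-identityʳ (ladderStart i) ⟩
        ladderStart i                          ≡⟨ p+1≡start ⟨
        suc p                                  ∎
      after-start : ∀ d b → pos (rungPath (d i)) b ≡ 1 → pos (fullPath d) (firstRung b) ≡ suc (suc p)
      after-start d b second = begin
        pos (fullPath d) (firstRung b)         ≡⟨ pos-fullPath-firstRung d i b ⟩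
        ladderStart i + pos (rungPath (d i)) b ≡⟨ cong (ladderStart i +_) second ⟩
        ladderStart i + 1                      ≡⟨ +-comm (ladderStart i) 1 ⟩
        suc (ladderStart i)                    ≡⟨ cong suc p+1≡start ⟨
        suc (suc p)                            ∎

-- Indexing the paths by Fin (2 ^ l)

funToFin-cong : ∀ {m k} {f g : Fin m → Fin k} → f ≗ g → funToFin f ≡ funToFin g
funToFin-cong {zero}  _   = refl
funToFin-cong {suc m} f≗g = cong₂ combine (f≗g zero) (funToFin-cong (f≗g ∘ suc))

finToFun-injective : ∀ {m k} {s t : Fin (k ^ m)} → finToFun {k} {m} s ≗ finToFun t → s ≡ t
finToFun-injective {m} {k} {s} {t} s≗t = begin
  s                                 ≡⟨ funToFin-finToFin {m} {k} s ⟨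
  funToFin (finToFun {k} {m} s)     ≡⟨ funToFin-cong s≗t ⟩
  funToFin (finToFun {k} {m} t)     ≡⟨ funToFin-finToFin {m} {k} t ⟩
  t                                 ∎
  where open ≡-Reasoning

orientation : ∀ l → Fin (2 ^ l) → Fin l → Bool
orientation l t = Inverse.to 2↔Bool ∘ finToFun {2} {l} t

orientation-injective : ∀ l {s t : Fin (2 ^ l)} → orientation l s ≗ orientation l t → s ≡ t
orientation-injective l {s} {t} s≗t = finToFun-injective {l} {2} λ i → begin
  finToFun {2} {l} s i                      ≡⟨ Inverse.strictlyInverseʳ 2↔Bool _ ⟨
  Inverse.from 2↔Bool (orientation l s i)   ≡⟨ cong (Inverse.from 2↔Bool) (s≗t i) ⟩
  Inverse.from 2↔Bool (orientation l t i)   ≡⟨ Inverse.strictlyInverseʳ 2↔Bool _ ⟩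
  finToFun {2} {l} t i                      ∎
  where open ≡-Reasoning

lemma2p5 : (l : ℕ) (ks : Fin l → ℕ) → (∀ i → 1 ≤ ks i) →
           (r : Residual) → ValidResidual r →
           Σ (Fin (2 ^ l) → HamPath (PLV l ks r)) λ P →
             (∀ t → GType (PLE l ks r) (P t)) ×
             (∀ s t → s ≢ t → UnionHasTriangle (P s) (P t))
lemma2p5 l ks ks≥1 r _ = fullPath ks r ∘ orientation l , fullPath-GType ks r ∘ orientation l , triangle
  where
  triangle : ∀ s t → s ≢ t → UnionHasTriangle (fullPath ks r (orientation l s)) (fullPath ks r (orientation l t))
  triangle s t s≢t
    with ¬∀⟶∃¬-smallest l _ (λ i → orientation l s i ≟ᵇ orientation l t i) (s≢t ∘ orientation-injective l)
  ... | i , differ , agree = fullPath-triangle ks r ks≥1 (orientation l s) (orientation l t) i differ agree
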